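{- Let $\mathcal{P}$ be a partition of a finite subset of the set of participant names. Let $\{\Lambda_i\}_{i\in I}$ be $\mathcal{P}$-coherent for the session $\mathbb{M}$ and let $\Lambda\in\mathrm{LL}(\mathbb{M})$ with $\Lambda\neq\Lambda_i$ for all $i\in I$. Then $\mathrm{prt}(\Lambda)\cap\mathrm{prt}(\Lambda_i)=\emptyset$ for all $i\in I$.
   Context: Processes are the regular, possibly infinite, terms coinductively generated by $P ::= \mathbf{0} \mid \Sigma_{i\in I}\pi_i.P_i$, where $I$ is finite and nonempty, each action prefix $\pi_i$ is an input $\mathsf{p}?\lambda$ or an output $\mathsf{p}!\lambda$ ($\mathsf{p}$ a participant name, $\lambda$ a message), and in one sum two distinct input prefixes from the same participant carry different messages, and likewise for two output prefixes to the same participant; sums are modulo commutativity and associativity. $\mathrm{prt}(\mathsf{p}?\lambda)=\mathrm{prt}(\mathsf{p}!\lambda)=\{\mathsf{p}\}$, $\mathrm{prt}(\mathbf{0})=\emptyset$, $\mathrm{prt}(\Sigma_{i\in I}\pi_i.P_i)=\bigcup_i\mathrm{prt}(\pi_i)\cup\bigcup_i\mathrm{prt}(P_i)$. A session is $\mathbb{M}=\mathsf{p}_1[\![P_1]\!]\parallel\cdots\parallel\mathsf{p}_n[\![P_n]\!]$ with pairwise distinct $\mathsf{p}_j$, up to structural congruence $\equiv$ (parallel composition commutative, associative, with $\mathsf{p}[\![\mathbf{0}]\!]$ neutral). $\mathsf{p}[\![P]\!]\in\mathbb{M}$ means $\mathbb{M}\equiv\mathsf{p}[\![P]\!]\parallel\mathbb{M}'$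 with $P\neq\mathbf{0}$; $\mathrm{prt}(\mathbb{M})=\{\mathsf{p}\mid \mathsf{p}[\![P]\!]\in\mathbb{M}\}$. Labels are $\Lambda=\mathsf{p}\lambda\mathsf{q}$ with $\mathrm{prt}(\mathsf{p}\lambda\mathsf{q})=\{\mathsf{p},\mathsf{q}\}$; the session transition relation is the closure under $\equiv$ of $\mathsf{p}[\![\mathsf{q}!\lambda.P + P']\!]\parallel\mathsf{q}[\![\mathsf{p}?\lambda.Q + Q']\!]\parallel\mathbb{M}\xrightarrow{\mathsf{p}\lambda\mathsf{q}}\mathsf{p}[\![P]\!]\parallel\mathsf{q}[\![Q]\!]\parallel\mathbb{M}$, where each of the summands $+P'$, $+Q'$ may be absent. $\mathrm{LL}(\mathbb{M})=\{\Lambda\mid \mathbb{M}\xrightarrow{\Lambda}\mathbb{M}''\text{ for some }\mathbb{M}''\}$. For a set of participants $\mathbf{P}$, a process $P$ is $\mathbf{P}$-connecting if for every subterm $\Sigma_{i\in I}\pi_i.P_i$ of $P$: if $\mathrm{prt}(\pi_j)\not\subseteq\mathbf{P}$ for some $j\in I$ then $\mathrm{prt}(\pi_i)=\mathrm{prt}(\pi_j)$ for all $i\in I$. If $\mathsf{p}[\![P]\!]\in\mathbb{M}$, then $\mathsf{p}$ is a connector for $\mathbb{M}$ if $P$ is $\mathrm{prt}(\mathbb{M})$-connecting and some $\mathsf{q}\in\mathrm{prt}(P)$ has $\mathsf{q}\notin\mathrm{prt}(\mathbb{M})$. $\mathbb{M}'$ is a subsession of $\mathbb{M}$ if $\mathsf{p}[\![P]\!]\in\mathbb{M}'$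 implies $\mathsf{p}[\![P]\!]\in\mathbb{M}$. A partition of $\mathbb{M}$ is a set of subsessions $\{\mathbb{M}_h\}_{h\in H}$ with $\mathrm{prt}(\mathbb{M})=\bigcup_h\mathrm{prt}(\mathbb{M}_h)$ and the $\mathrm{prt}(\mathbb{M}_h)$ pairwise disjoint. For a partition $\mathcal{P}=\{\mathbf{P}_k\}_{k\in K}$ of a finite set of participants, a partition $\{\mathbb{M}_h\}_{h\in H}$ of $\mathbb{M}$ is a $\mathcal{P}$-partition if $H\subseteq K$ and $\mathrm{prt}(\mathbb{M}_h)\subseteq\mathbf{P}_h$ for all $h$; it is a $\mathcal{P}$-modularisation of $\mathbb{M}$ if for all $h\in H$: (i) each $\mathsf{p}[\![P]\!]\in\mathbb{M}_h$ either has $\mathsf{p}$ a connector for $\mathbb{M}_h$, or every $\mathsf{q}\in\mathrm{prt}(P)\cap\mathrm{prt}(\mathbb{M})$ lies in $\mathrm{prt}(\mathbb{M}_h)$; (ii) for each connector $\mathsf{p}[\![P]\!]\in\mathbb{M}_h$ and each $\mathsf{q}\in\mathrm{prt}(P)\setminus\mathrm{prt}(\mathbb{M}_h)$, if $\mathsf{q}\in\mathrm{prt}(\mathbb{M}_k)$ then $\mathsf{q}$ is a connector for $\mathbb{M}_k$. $\mathbb{M}$ is $\mathcal{P}$-modularisable if it has a $\mathcal{P}$-modularisation (it is then unique). A set of labels $\{\Lambda_i\}_{i\in I}$ is $\mathcal{P}$-coherent for $\mathbb{M}$ if $\mathbb{M}$ is $\mathcal{P}$-modularisable and some element $\widehat{\mathbb{M}}$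 of its $\mathcal{P}$-modularisation satisfies $\{\Lambda_i\}_{i\in I}=\{\Lambda\in\mathrm{LL}(\mathbb{M})\mid \mathrm{prt}(\Lambda)\cap\mathrm{prt}(\widehat{\mathbb{M}})\neq\emptyset\}$. -}

module Defs where

open import Data.Nat using (ℕ)
open import Data.Fin using (Fin)
open import Data.List using (List; []; map)
open import Data.List.Membership.Propositional using (_∈_)
open import Data.List.Relation.Unary.Unique.Propositional using (Unique)
open import Data.Maybe using (Maybe; just)
open import Data.Product using (Σ; _×_; _,_; ∃; proj₁)
open import Data.Sum using (_⊎_)
open import Data.Empty using (⊥)
open import Relation.Nullary using (¬_)
open import Relation.Binary.PropositionalEquality using (_≡_; _≢_)

Participant : Set
Participant = ℕ

Message : Set
Message = ℕ

-- action prefixes:  inp p λ  is  p?λ ,  out p λ  is  p!λ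
data Action : Set where
  inp : Participant → Message → Action
  out : Participant → Message → Action

actPrt : Action → Participant
actPrt (inp p _) = p
actPrt (out p _) = p

-- Processes: regular (possibly infinite) terms, presented as finite
-- graphs.  State s denotes the term  Σ_{(π,t) ∈ body s} π . [t] ,
-- where an empty body denotes 0.  The process is the unfolding of the
-- root state.  Sums are lists, whose order is irrelevant to every
-- notion below (commutativity/associativity).  'wf' says that within
-- one sum the action prefixes are pairwise distinct (two inputs from the
-- same participant carry different messages, likewise for outputs).

record Proc : Set where
  constructor proc
  field
    size : ℕ
    body : Fin size → List (Action × Fin size)
    root : Fin size
    wf   : ∀ s → Unique (map proj₁ (body s))

open Proc public

-- states reachable from a state (these are exactly the subterms)
data Reach (P : Proc) : Fin (size P) → Fin (size P) → Set where
  here  : ∀ {s} → Reach P s s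
  there : ∀ {s a t u} → (a , t) ∈ body P s → Reach P t u → Reach P s u

NonNil : Proc → Set
NonNil P = body P (root P) ≢ []

_∈prt_ : Participant → Proc → Set
q ∈prt P = Σ (Fin (size P)) λ s → Reach P (root P) s ×
             Σ Action λ a → Σ (Fin (size P)) λ t → (a , t) ∈ body P s × actPrt a ≡ q

Connecting : (Participant → Set) → Proc → Set
Connecting 𝐏 P = ∀ s → Reach P (root P) s →
  ∀ a t → (a , t) ∈ body P s → ¬ 𝐏 (actPrt a) →
  ∀ b u → (b , u) ∈ body P s → actPrt b ≡ actPrt a

-- Sessions: finitely many components with pairwise distinct names.
-- Components p⟦0⟧ are allowed in the list and are neutral.

record Session : Set where
  constructor session
  field
    comps  : List (Participant × Proc)
    unique : Unique (map proj₁ comps)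

open Session public

_⟦_⟧∈_ : Participant → Proc → Session → Set
p ⟦ P ⟧∈ M = (p , P) ∈ comps M × NonNil P

_∈prtS_ : Participant → Session → Set
p ∈prtS M = Σ Proc λ P → p ⟦ P ⟧∈ M

record Label : Set where
  constructor lab
  field
    sender   : Participant
    msg      : Message
    receiver : Participant

open Label public

_∈prtL_ : Participant → Label → Set
r ∈prtL Λ = r ≡ sender Λ ⊎ r ≡ receiver Λ

-- Λ ∈ LL(M): M can perform a transition labelled Λ, i.e. (the rule)
-- p⟦q!λ.P + P'⟧ ∥ q⟦p?λ.Q + Q'⟧ ∥ M'  with p, q distinct components.
_∈LL_ : Label → Session → Set
lab p λ' q ∈LL M = p ≢ q × Σ Proc λ P → Σ Proc λ Q →
  p ⟦ P ⟧∈ M × q ⟦ Q ⟧∈ M ×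
  Σ (Fin (size P)) (λ t → (out q λ' , t) ∈ body P (root P)) ×
  Σ (Fin (size Q)) (λ u → (inp p λ' , u) ∈ body Q (root Q))

Connector : Session → Participant → Proc → Set
Connector M p P = p ⟦ P ⟧∈ M × Connecting (λ r → r ∈prtS M) P ×
                  Σ Participant λ q → q ∈prt P × ¬ (q ∈prtS M)

IsConnector : Session → Participant → Set
IsConnector M p = Σ Proc λ P → Connector M p P

Subsession : Session → Session → Set
Subsession M' M = ∀ p P → p ⟦ P ⟧∈ M' → p ⟦ P ⟧∈ M

record PartPartition : Set where
  field
    k        : ℕ
    block    : Fin k → List Participant
    nonempty : ∀ h → block h ≢ []
    disjoint : ∀ h h' → h ≢ h' → ∀ p → p ∈ block h → p ∈ block h' → ⊥

open PartPartition public

-- A family {M_h}_{h ∈ H} with H ⊆ K: F h ≡ just M_h  iff  h ∈ H.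
Family : PartPartition → Set
Family 𝒫 = Fin (k 𝒫) → Maybe Session

IsPPartition : (𝒫 : PartPartition) → Session → Family 𝒫 → Set
IsPPartition 𝒫 M F =
  (∀ h Mh → F h ≡ just Mh → Subsession Mh M) ×
  (∀ p → p ∈prtS M → Σ (Fin (k 𝒫)) λ h → Σ Session λ Mh → F h ≡ just Mh × p ∈prtS Mh) ×
  (∀ h Mh p → F h ≡ just Mh → p ∈prtS Mh → p ∈prtS M) ×
  (∀ h h' Mh Mh' → h ≢ h' → F h ≡ just Mh → F h' ≡ just Mh' →
     ∀ p → p ∈prtS Mh → p ∈prtS Mh' → ⊥) ×
  (∀ h Mh p → F h ≡ just Mh → p ∈prtS Mh → p ∈ block 𝒫 h)

IsModularisation : (𝒫 : PartPartition) → Session → Family 𝒫 → Set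
IsModularisation 𝒫 M F =
  IsPPartition 𝒫 M F ×
  -- (i)
  (∀ h Mh → F h ≡ just Mh → ∀ p P → p ⟦ P ⟧∈ Mh →
     Connector Mh p P ⊎ (∀ q → q ∈prt P → q ∈prtS M → q ∈prtS Mh)) ×
  -- (ii)
  (∀ h Mh → F h ≡ just Mh → ∀ p P → Connector Mh p P →
     ∀ q → q ∈prt P → ¬ (q ∈prtS Mh) →
     ∀ h' Mk → F h' ≡ just Mk → q ∈prtS Mk → IsConnector Mk q)

Modularisable : PartPartition → Session → Set
Modularisable 𝒫 M = Σ (Family 𝒫) λ F → IsModularisation 𝒫 M F

Coherent : (𝒫 : PartPartition) → Session → (I : Set) → (I → Label) → Set
Coherent 𝒫 M I Λs = Σ (Family 𝒫) λ F → IsModularisation 𝒫 M F ×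
  Σ (Fin (k 𝒫)) λ h → Σ Session λ M̂ → F h ≡ just M̂ ×
  (∀ Λ → ((Σ I λ i → Λs i ≡ Λ) → Λ ∈LL M × Σ Participant (λ r → r ∈prtL Λ × r ∈prtS M̂)) ×
         (Λ ∈LL M × Σ Participant (λ r → r ∈prtL Λ × r ∈prtS M̂) → Σ I λ i → Λs i ≡ Λ))

-- Λ shares no participant with the block M̂ witnessing coherence (else Λ would be some
-- Λᵢ), so if it met some Λᵢ in r, then r ∉ M̂ and Λᵢ joins r to some x ∈ M̂. The process
-- of x then mentions r outside M̂, so by condition (i) x is a connector; by (ii) r is a
-- connector of its own block, which does not contain x. Connecting processes whose root
-- offers an action to an outsider offer actions to that outsider only, so the partner of
-- r in Λ is x as well: x ∈ prt(Λ).
module Submission where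

open import Defs
open import Data.Empty using (⊥; ⊥-elim)
open import Data.List using (List; _∷_; map)
open import Data.List.Membership.Propositional using (_∈_)
open import Data.List.Membership.Propositional.Properties using (∈-map⁺)
open import Data.List.Relation.Unary.Any using (here; there)
open import Data.List.Relation.Unary.AllPairs using (_∷_)
open import Data.List.Relation.Unary.Unique.Propositional using (Unique)
open import Data.List.Relation.Unary.Unique.Propositional.Properties using (Unique[x∷xs]⇒x∉xs)
open import Data.Fin using (_≟_)
open import Data.Maybe using (just)
open import Data.Maybe.Properties using (just-injective)
open import Data.Product using (Σ; ∃; _×_; _,_; proj₁; proj₂)
open import Data.Sum using (inj₁; inj₂)
open import Relation.Nullary using (¬_; yes; no)
open import Relation.Binary.PropositionalEquality using (_≡_; _≢_; refl; sym; trans; subst)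

proj₁-unique⇒functional : ∀ {A B : Set} {a : A} {b c : B} (xs : List (A × B)) →
  Unique (map proj₁ xs) → (a , b) ∈ xs → (a , c) ∈ xs → b ≡ c
proj₁-unique⇒functional (_ ∷ _)  _       (here refl) (here refl) = refl
proj₁-unique⇒functional (_ ∷ xs) u       (here refl) (there ac)  = ⊥-elim (Unique[x∷xs]⇒x∉xs u (∈-map⁺ proj₁ ac))
proj₁-unique⇒functional (_ ∷ xs) u       (there ab)  (here refl) = ⊥-elim (Unique[x∷xs]⇒x∉xs u (∈-map⁺ proj₁ ab))
proj₁-unique⇒functional (_ ∷ xs) (_ ∷ u) (there ab)  (there ac)  = proj₁-unique⇒functional xs u ab ac

⟦⟧∈-functional : ∀ (M : Session) {p P Q} → p ⟦ P ⟧∈ M → p ⟦ Q ⟧∈ M → P ≡ Q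
⟦⟧∈-functional M (pP , _) (pQ , _) = proj₁-unique⇒functional (comps M) (unique M) pP pQ

data Ends (Λ : Label) : Participant → Participant → Set where
  sender→receiver : Ends Λ (sender Λ) (receiver Λ)
  receiver→sender : Ends Λ (receiver Λ) (sender Λ)

Ends-sym : ∀ {Λ y z} → Ends Λ y z → Ends Λ z y
Ends-sym sender→receiver = receiver→sender
Ends-sym receiver→sender = sender→receiver

Ends⇒∈prtL : ∀ {Λ y z} → Ends Λ y z → z ∈prtL Λ
Ends⇒∈prtL sender→receiver = inj₂ refl
Ends⇒∈prtL receiver→sender = inj₁ refl

∈prtL⇒Ends : ∀ Λ {y} → y ∈prtL Λ → ∃ (Ends Λ y)
∈prtL⇒Ends Λ (inj₁ refl) = receiver Λ , sender→receiver
∈prtL⇒Ends Λ (inj₂ refl) = sender Λ , receiver→sender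

≢⇒Ends : ∀ Λ {x y} → x ∈prtL Λ → y ∈prtL Λ → y ≢ x → Ends Λ x y
≢⇒Ends Λ (inj₁ refl) (inj₁ refl) y≢x = ⊥-elim (y≢x refl)
≢⇒Ends Λ (inj₁ refl) (inj₂ refl) _   = sender→receiver
≢⇒Ends Λ (inj₂ refl) (inj₁ refl) _   = receiver→sender
≢⇒Ends Λ (inj₂ refl) (inj₂ refl) y≢x = ⊥-elim (y≢x refl)

data _∈rootPrt_ (q : Participant) (P : Proc) : Set where
  root-action : ∀ {a t} → (a , t) ∈ body P (root P) → actPrt a ≡ q → q ∈rootPrt P

∈rootPrt⇒∈prt : ∀ {q P} → q ∈rootPrt P → q ∈prt P
∈rootPrt⇒∈prt {P = P} (root-action at a≡q) = root P , here , _ , _ , at , a≡q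

Connecting⇒root-prt-unique : ∀ 𝐏 {P q q'} → Connecting 𝐏 P →
  q ∈rootPrt P → ¬ 𝐏 q → q' ∈rootPrt P → q' ≡ q
Connecting⇒root-prt-unique 𝐏 {P} conn (root-action at refl) ¬𝐏q (root-action bu refl) =
  conn (root P) here _ _ at ¬𝐏q _ _ bu

∈LL⇒∈rootPrt : ∀ {Λ} M {y z P} → Λ ∈LL M → Ends Λ y z → y ⟦ P ⟧∈ M → z ∈rootPrt P
∈LL⇒∈rootPrt {lab p m q} M (_ , P , _ , pP , _ , (_ , tP) , _) sender→receiver yP'
  rewrite ⟦⟧∈-functional M yP' pP = root-action tP refl
∈LL⇒∈rootPrt {lab p m q} M (_ , _ , Q , _ , qQ , _ , (_ , uQ)) receiver→sender yQ'
  rewrite ⟦⟧∈-functional M yQ' qQ = root-action uQ refl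

∈LL⇒∈prtS : ∀ Λ M {y} → Λ ∈LL M → y ∈prtL Λ → y ∈prtS M
∈LL⇒∈prtS _ _ (_ , P , _ , pP , _) (inj₁ refl) = P , pP
∈LL⇒∈prtS _ _ (_ , _ , Q , _ , qQ , _) (inj₂ refl) = Q , qQ

PPartition-member-unique : ∀ {𝒫 M F h h' Mh Mh' p} → IsPPartition 𝒫 M F →
  F h ≡ just Mh → F h' ≡ just Mh' → p ∈prtS Mh → p ∈prtS Mh' → Mh ≡ Mh'
PPartition-member-unique {h = h} {h'} (_ , _ , _ , disjoint , _) Fh Fh' pMh pMh' with h ≟ h'
... | yes refl = just-injective (trans (sym Fh) Fh')
... | no h≢h'  = ⊥-elim (disjoint _ _ _ _ h≢h' Fh Fh' _ pMh pMh')

Modularisation-crossing : ∀ {𝒫 M F h M̂ x P r} → IsModularisation 𝒫 M F → F h ≡ just M̂ →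
  x ⟦ P ⟧∈ M̂ → r ∈prt P → r ∈prtS M → ¬ r ∈prtS M̂ →
  Σ Session λ Mk → Σ Proc λ R → r ⟦ R ⟧∈ M × Connecting (_∈prtS Mk) R × ¬ x ∈prtS Mk
Modularisation-crossing {𝒫} {M} {F} {M̂ = M̂} {x} {P} {r}
  (partition@(sub , cover , _) , closed-or-connector , connectors-meet) Fh xP rP rM r∉M̂
  with closed-or-connector _ _ Fh _ _ xP
... | inj₂ closed = ⊥-elim (r∉M̂ (closed r rP rM))
... | inj₁ x-connector with cover r rM
... | k , Mk , Fk , rMk with connectors-meet _ _ Fh _ _ x-connector r rP r∉M̂ k Mk Fk rMk
... | R , rR , R-connecting , _ = Mk , R , sub k Mk Fk r R rR , R-connecting , x∉Mk
  where
    x∉Mk : ¬ x ∈prtS Mk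
    x∉Mk xMk = r∉M̂ (subst (r ∈prtS_) Mk≡M̂ rMk)
      where
        Mk≡M̂ : Mk ≡ M̂
        Mk≡M̂ = PPartition-member-unique {𝒫} {M} {F} partition Fk Fh xMk (P , xP)

mainTheorem11 : (𝒫 : PartPartition) (M : Session) (I : Set) (Λs : I → Label) →
    Coherent 𝒫 M I Λs →
    (Λ : Label) → Λ ∈LL M → (∀ i → Λ ≢ Λs i) →
    ∀ i r → r ∈prtL Λ → r ∈prtL Λs i → ⊥
mainTheorem11 𝒫 M I Λs (F , modularisation , h , M̂ , Fh , coherent) Λ ΛLL Λ≢Λs i r rΛ rΛᵢ =
  let Λᵢ-LL , x , xΛᵢ , P , xP = proj₁ (coherent (Λs i)) (i , refl)
      x-r = ≢⇒Ends (Λs i) xΛᵢ rΛᵢ (λ r≡x → r∉M̂ (subst (_∈prtS M̂) (sym r≡x) (P , xP)))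
      r∈P = ∈rootPrt⇒∈prt (∈LL⇒∈rootPrt M Λᵢ-LL x-r (M̂⊆M _ _ xP))
      Mk , R , rR , R-connecting , x∉Mk =
        Modularisation-crossing {𝒫} {M} {F} modularisation Fh xP r∈P (∈LL⇒∈prtS Λ M ΛLL rΛ) r∉M̂
      z , r-z = ∈prtL⇒Ends Λ rΛ
      z≡x = Connecting⇒root-prt-unique (_∈prtS Mk) R-connecting
              (∈LL⇒∈rootPrt M Λᵢ-LL (Ends-sym x-r) rR) x∉Mk (∈LL⇒∈rootPrt M ΛLL r-z rR)
  in Λ-avoids-M̂ (subst (_∈prtL Λ) z≡x (Ends⇒∈prtL r-z)) (P , xP)
  where
    M̂⊆M : Subsession M̂ M
    M̂⊆M = proj₁ (proj₁ modularisation) h M̂ Fh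

    Λ-avoids-M̂ : ∀ {y} → y ∈prtL Λ → ¬ y ∈prtS M̂
    Λ-avoids-M̂ yΛ yM̂ with proj₂ (coherent Λ) (ΛLL , _ , yΛ , yM̂)
    ... | j , Λⱼ≡Λ = Λ≢Λs j (sym Λⱼ≡Λ)

    r∉M̂ : ¬ r ∈prtS M̂
    r∉M̂ = Λ-avoids-M̂ rΛ
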